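{- Let $q$ be a prime power and let $k,k',d,d'$ be positive integers with $q\geq dk+1$, $k'\geq k$, $d'\geq d$ and $q^2\geq d'k'+1$. Let $C_{q,k,d}$ and $C_{q^2,k',d'}$ be the matrices defined in the context. Then there exists a matrix $\mathbf{C}_{q^2,k',d'}$ obtained from $C_{q^2,k',d'}$ by a permutation of rows and a permutation of columns that has the block form \[\mathbf{C}_{q^2,k',d'}=\begin{pmatrix} C_{q,k,d} & Y\\ Z & W\end{pmatrix}\] for some matrices $Y,Z,W$. Moreover, $\mathbf{C}_{q^2,k',d'}$ is the incidence matrix of a $d'$-CFF$((d'k'+1)q^2,\, q^{2(k'+1)})$ and $C_{q,k,d}$ is the incidence matrix of a $d$-CFF$((dk+1)q,\, q^{k+1})$.
   Context: A $d$-CFF$(t,n)$ is a set system $(X,\mathcal{B})$, $|X|=t$, $\mathcal{B}=\{B_1,\dots,B_n\}$, $B_i\subseteq X$, such that no $B_{i_0}\in\mathcal{B}$ is contained in the union of any $d$ other members of $\mathcal{B}$; it is represented by its $t\times n$ binary incidence matrix. For a prime power $r$ with the elements of $\mathbb{F}_r$ listed in a fixed order $x_1,\dots,x_r$, and positive integers $\kappa,\delta$ with $r\ge \delta\kappa+1$, the matrix $C_{r,\kappa,\delta}$ has rows indexed by pairs $(x_i,y)$ with $1\le i\le \delta\kappa+1$ and $y\in\mathbb{F}_r$, columns indexed by polynomials $f\in\mathbb{F}_r[x]$ of degree at most $\kappa$, and entry $1$ iff $f(x_i)=y$ (and $0$ otherwise). The orderings are chosen compatibly: $\mathbb{F}_q$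 is viewed as the subfield of $\mathbb{F}_{q^2}$, and the ordering of $\mathbb{F}_{q^2}$ lists the elements of $\mathbb{F}_q$ first, in the same order used for $\mathbb{F}_q$. -}

module Defs where

open import Data.Nat as ℕ using (ℕ; zero; suc; _^_; _≤_)
open import Data.Nat.Primality using (Prime)
open import Data.Fin as Fin using (Fin; toℕ; inject≤; quotRem)
open import Data.Fin.Permutation using (Permutation′; _⟨$⟩ʳ_)
open import Data.Vec using (Vec; []; _∷_)
open import Data.Bool using (Bool; true; false)
open import Data.Product using (Σ; ∃; _×_; _,_; proj₁; proj₂)
open import Relation.Nullary.Decidable using (isYes)
open import Relation.Binary.PropositionalEquality using (_≡_; _≢_)
open import Algebra.Structures using (IsCommutativeRing)
open import Function.Definitions using (Injective)

IsPrimePower : ℕ → Set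
IsPrimePower q = Σ ℕ λ p → Σ ℕ λ m → Prime p × q ≡ p ^ suc m

-- A finite field of order q whose carrier is Fin q; the fixed ordering
-- x_1,…,x_q of its elements is the canonical order of Fin q.
record FiniteField (q : ℕ) : Set where
  field
    _+_ _*_ : Fin q → Fin q → Fin q
    -_      : Fin q → Fin q
    0# 1#   : Fin q
    isCommutativeRing : IsCommutativeRing _≡_ _+_ _*_ -_ 0# 1#
    0≢1     : 0# ≢ 1#
    inverse : ∀ x → x ≢ 0# → ∃ λ y → x * y ≡ 1#

-- ι : F_q → F_{q^2} is a field embedding (F_q viewed as subfield of F_{q^2}),
-- and the ordering of F_{q^2} lists the elements of F_q first, in the same
-- order: the i-th element of F_q is the i-th element of F_{q^2}.
record CompatibleSubfield {q Q : ℕ} (F : FiniteField q) (K : FiniteField Q)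
                          (ι : Fin q → Fin Q) : Set where
  private
    module F = FiniteField F
    module K = FiniteField K
  field
    pres-+  : ∀ a b → ι (a F.+ b) ≡ ι a K.+ ι b
    pres-*  : ∀ a b → ι (a F.* b) ≡ ι a K.* ι b
    pres-0  : ι F.0# ≡ K.0#
    pres-1  : ι F.1# ≡ K.1#
    ordered : ∀ a → toℕ (ι a) ≡ toℕ a

eval : ∀ {r n} → FiniteField r → Vec (Fin r) n → Fin r → Fin r
eval F []       x = FiniteField.0# F
eval F (c ∷ cs) x = c + (x * eval F cs x)
  where open FiniteField F

decodePoly : ∀ {r} (n : ℕ) → Fin (r ^ n) → Vec (Fin r) n
decodePoly zero    _ = []
decodePoly {r} (suc n) i with quotRem (r ^ n) i
... | (rest , c) = c ∷ decodePoly n rest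

-- The matrix C_{r,κ,δ}: rows = pairs (x_i , y), 1 ≤ i ≤ δκ+1, y ∈ F_r
-- (encoded as Fin ((δκ+1)·r)); columns = polynomials of degree ≤ κ
-- (encoded as Fin (r^(κ+1))); entry 1 iff f(x_i) = y.
C : ∀ {r} → FiniteField r → (κ δ : ℕ) → suc (δ ℕ.* κ) ≤ r →
    Fin (suc (δ ℕ.* κ) ℕ.* r) → Fin (r ^ suc κ) → Bool
C {r} F κ δ h row col with quotRem r row
... | (y , i) = isYes (eval F (decodePoly (suc κ) col) (inject≤ i h) Fin.≟ y)

permute : ∀ {t n} → (Fin t → Fin n → Bool) → Permutation′ t → Permutation′ n →
          Fin t → Fin n → Bool
permute M σ τ i j = M (σ ⟨$⟩ʳ i) (τ ⟨$⟩ʳ j)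

TopLeftBlock : ∀ {t n t' n'} → (Fin t → Fin n → Bool) → (Fin t' → Fin n' → Bool) → Set
TopLeftBlock {t} {n} {t'} {n'} M A =
  t' ≤ t × n' ≤ n ×
  (∀ (i : Fin t') (j : Fin n') (i' : Fin t) (j' : Fin n) →
     toℕ i ≡ toℕ i' → toℕ j ≡ toℕ j' → M i' j' ≡ A i j)

-- M (t × n) is the incidence matrix of a d-CFF(t,n): no column B_{j0} is
-- contained in the union of any d other (distinct) columns.
IsCFF : ∀ {t n} → ℕ → (Fin t → Fin n → Bool) → Set
IsCFF {t} {n} d M =
  ∀ (j₀ : Fin n) (S : Fin d → Fin n) → Injective _≡_ _≡_ S → (∀ a → S a ≢ j₀) →
  ∃ λ (x : Fin t) → M x j₀ ≡ true × (∀ a → M x (S a) ≡ false)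

-- Two distinct polynomials of degree at most κ over a field agree in at most κ points, so
-- among δκ + 1 distinct points there is one, x, at which a polynomial f differs from any
-- δ others; the row (x, f(x)) then separates column f from those δ columns, and C is a
-- δ-CFF.  Viewing F_q inside F_{q²}, a polynomial of degree ≤ k over F_q is one of
-- degree ≤ k′ over F_{q²}, and the first dk + 1 elements of F_{q²} are those of F_q; so
-- C_{q,k,d} is the submatrix of C_{q²,k′,d′} on the corresponding rows and columns.
-- Extending these two injections to permutations moves it to the top-left corner, and
-- permuting rows and columns preserves the CFF property.

module Submission where

open import Defs
open import Data.Nat using (ℕ; suc; _*_; _^_; _≤_)
open import Data.Fin using (Fin)
open import Data.Fin.Permutation using (Permutation′)
open import Data.Product using (Σ; _×_)

open import Level using (0ℓ)
open import Algebra.Bundles using (CommutativeRing)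
open import Data.Bool using (Bool; true; false)
open import Data.Nat as ℕ using (zero; z≤n; s≤s)
import Data.Nat.Properties as ℕ
open import Data.Fin as Fin
  using (toℕ; inject≤; inject₁; fromℕ; combine; remQuot; quotRem; quotient; remainder)
open import Data.Fin.Properties as Fin
  using (toℕ-injective; toℕ-inject≤; injective⇒≤; remQuot-combine; combine-remQuot)
open import Data.Fin.Relation.Unary.Top using (view; ‵fromℕ; ‵inject₁)
open import Data.Fin.Permutation
  using (_⟨$⟩ʳ_; _⟨$⟩ˡ_; inverseʳ; inverseˡ; id; transpose; _∘ₚ_)
import Data.Fin.Permutation.Components as PC
open import Data.Vec using (Vec; []; _∷_; map; replicate; padRight; truncate)
open import Data.Vec.Properties using (∷-injective; truncate-padRight)
open import Data.List as List using (List; []; _∷_; length; filter; allFin)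
open import Data.List.Properties using (length-map; length-tabulate)
open import Data.List.Relation.Unary.All as All using (All; []; _∷_)
open import Data.List.Relation.Unary.All.Properties using (all-filter)
open import Data.List.Relation.Unary.AllPairs using ([]; _∷_)
open import Data.List.Relation.Unary.Any using (here)
open import Data.List.Relation.Unary.Unique.Propositional using (Unique)
import Data.List.Relation.Unary.Unique.Propositional.Properties as Unique
open import Data.List.Membership.Propositional using (_∈_)
open import Data.List.Membership.Propositional.Properties using (∈-filter⁻; ∈-map⁻)
open import Data.Product as Product using (∃; _,_; proj₁; proj₂; uncurry)
open import Function using (_∘_; Injective)
open import Relation.Nullary using (¬_; yes; no; does; contradiction)
open import Relation.Nullary.Decidable using (isYes; isYes≗does; dec-true; dec-false)
open import Relation.Unary using (Pred; Decidable)
open import Relation.Unary.Properties using (∁?)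
open import Relation.Binary.PropositionalEquality

module _ {A : Set} {P : Pred A 0ℓ} (P? : Decidable P) where

  length-filter+length-filter-∁ : ∀ xs → length (filter P? xs) ℕ.+ length (filter (∁? P?) xs) ≡ length xs
  length-filter+length-filter-∁ []       = refl
  length-filter+length-filter-∁ (x ∷ xs) with does (P? x)
  ... | true  = cong suc (length-filter+length-filter-∁ xs)
  ... | false = trans (ℕ.+-suc _ _) (cong suc (length-filter+length-filter-∁ xs))

avoid-sparse : ∀ {A : Set} {k} d (P : Fin d → Pred A 0ℓ) → (∀ a → Decidable (P a)) →
               (∀ a ys → Unique ys → All (P a) ys → length ys ≤ k) →
               (xs : List A) → Unique xs → suc (d * k) ≤ length xs → ∃ λ x → x ∈ xs × ∀ a → ¬ P a x
avoid-sparse zero    P P? sparse (x ∷ _) _ _ = x , here refl , λ ()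
avoid-sparse {k = k} (suc d) P P? sparse xs xs-unique d*k<|xs|
  with avoid-sparse d (P ∘ Fin.suc) (P? ∘ Fin.suc) (sparse ∘ Fin.suc)
                    outside (Unique.filter⁺ _ xs-unique) d*k<|outside|
  where
  outside = filter (∁? (P? Fin.zero)) xs
  inside  = filter (P? Fin.zero) xs
  d*k<|outside| : suc (d * k) ≤ length outside
  d*k<|outside| = ℕ.+-cancelˡ-≤ k _ _ (begin
    k ℕ.+ suc (d * k)                 ≡⟨ ℕ.+-suc k (d * k) ⟩
    suc (k ℕ.+ d * k)                 ≤⟨ d*k<|xs| ⟩
    length xs                         ≡⟨ length-filter+length-filter-∁ (P? Fin.zero) xs ⟨
    length inside ℕ.+ length outside  ≤⟨ ℕ.+-monoˡ-≤ _ |inside|≤k ⟩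
    k ℕ.+ length outside              ∎)
    where
    open ℕ.≤-Reasoning
    |inside|≤k : length inside ≤ k
    |inside|≤k = sparse Fin.zero inside (Unique.filter⁺ _ xs-unique) (all-filter _ xs)
... | x , x∈outside , ¬Px with ∈-filter⁻ (∁? (P? Fin.zero)) {xs = xs} x∈outside
... | x∈xs , ¬P₀x = x , x∈xs , λ { Fin.zero → ¬P₀x ; (Fin.suc a) → ¬Px a }

map-injective : ∀ {A B : Set} {f : A → B} {n} → Injective _≡_ _≡_ f → Injective _≡_ _≡_ (map {n = n} f)
map-injective f-injective {[]}    {[]}    _ = refl
map-injective f-injective {_ ∷ _} {_ ∷ _} e with ∷-injective e
... | fx≡fy , fxs≡fys = cong₂ _∷_ (f-injective fx≡fy) (map-injective f-injective fxs≡fys)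

padRight-injective : ∀ {A : Set} {m n} (m≤n : m ≤ n) (a : A) → Injective _≡_ _≡_ (padRight m≤n a)
padRight-injective m≤n a {u} {v} e =
  trans (sym (truncate-padRight m≤n a u)) (trans (cong (truncate m≤n) e) (truncate-padRight m≤n a v))

isYes-≟-injective : ∀ {m n} {f : Fin m → Fin n} → Injective _≡_ _≡_ f →
                    ∀ a b → isYes (f a Fin.≟ f b) ≡ isYes (a Fin.≟ b)
isYes-≟-injective {f = f} f-injective a b with a Fin.≟ b
... | yes a≡b = trans (isYes≗does (f a Fin.≟ f b)) (dec-true (f a Fin.≟ f b) (cong f a≡b))
... | no  a≢b = trans (isYes≗does (f a Fin.≟ f b)) (dec-false (f a Fin.≟ f b) (a≢b ∘ f-injective))

quotRem-combine : ∀ {m} n (i : Fin m) (y : Fin n) → quotRem n (combine i y) ≡ (y , i)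
quotRem-combine n i y = cong Product.swap (remQuot-combine i y)

module _ {m n m′ n′} (f : Fin m → Fin m′) (g : Fin n → Fin n′) where

  combine-map : Fin (m * n) → Fin (m′ * n′)
  combine-map = uncurry combine ∘ Product.map f g ∘ remQuot n

  combine-map-combine : ∀ i j → combine-map (combine i j) ≡ combine (f i) (g j)
  combine-map-combine i j = cong (uncurry combine ∘ Product.map f g) (remQuot-combine i j)

  combine-map-injective : Injective _≡_ _≡_ f → Injective _≡_ _≡_ g → Injective _≡_ _≡_ combine-map
  combine-map-injective f-injective g-injective {x} {y} e with Fin.combine-injective _ _ _ _ e
  ... | fi≡fi′ , gj≡gj′ = begin
    x                                ≡⟨ combine-remQuot {m} n x ⟨
    uncurry combine (remQuot {m} n x)  ≡⟨ cong₂ combine (f-injective fi≡fi′) (g-injective gj≡gj′) ⟩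
    uncurry combine (remQuot {m} n y)  ≡⟨ combine-remQuot {m} n y ⟩
    y                                ∎
    where open ≡-Reasoning

module FieldPolynomials {r : ℕ} (F : FiniteField r) where

  commutativeRing : CommutativeRing 0ℓ 0ℓ
  commutativeRing = record { isCommutativeRing = FiniteField.isCommutativeRing F }

  open FiniteField F using (0#; 1#; inverse)
  open CommutativeRing commutativeRing renaming (_*_ to _·_)
    using (_+_; -_; _-_; +-assoc; +-identityʳ; -‿inverseʳ; zeroˡ; zeroʳ;
           *-identityˡ; *-assoc; *-comm; ring; commutativeSemiring)
  open import Algebra.Properties.Ring ring using (+-cancelˡ; +-cancelʳ; xyx⁻¹≈y; x∙y⁻¹≈ε⇒x≈y)
  open import Algebra.Solver.Ring.NaturalCoefficients.Default commutativeSemiring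
    using (solve; _:+_; _:*_; _:=_)

  Poly : ℕ → Set
  Poly n = Vec (Fin r) n

  ⟦_⟧ : ∀ {n} → Poly n → Fin r → Fin r
  ⟦_⟧ = eval F

  *-cancelˡ-nonZero : ∀ c {x y} → c ≢ 0# → c · x ≡ c · y → x ≡ y
  *-cancelˡ-nonZero c {x} {y} c≢0 cx≡cy with inverse c c≢0
  ... | c⁻¹ , cc⁻¹≡1 = begin
    x               ≡⟨ cancel x ⟨
    c⁻¹ · (c · x)   ≡⟨ cong (c⁻¹ ·_) cx≡cy ⟩
    c⁻¹ · (c · y)   ≡⟨ cancel y ⟩
    y               ∎
    where
    open ≡-Reasoning
    cancel : ∀ z → c⁻¹ · (c · z) ≡ z
    cancel z = begin
      c⁻¹ · (c · z)  ≡⟨ *-assoc c⁻¹ c z ⟨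
      (c⁻¹ · c) · z  ≡⟨ cong (_· z) (trans (*-comm c⁻¹ c) cc⁻¹≡1) ⟩
      1# · z         ≡⟨ *-identityˡ z ⟩
      z              ∎

  a+[x-a]≡x : ∀ a x → a + (x - a) ≡ x
  a+[x-a]≡x a x = trans (sym (+-assoc a x (- a))) (xyx⁻¹≈y a x)

  divide : ∀ {n} → Fin r → Poly (suc n) → Poly n × Fin r
  divide a (c ∷ [])         = [] , c
  divide a (c ∷ cs@(_ ∷ _)) with divide a cs
  ... | Q , ρ = ρ ∷ Q , c + a · ρ

  -- Stated with x = a + t, so that it is a semiring identity the natural-coefficient solver proves.
  horner-step : ∀ c a t ρ E → c + (a + t) · (ρ + t · E) ≡ (c + a · ρ) + t · (ρ + (a + t) · E)
  horner-step = solve 5 (λ c a t ρ E →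
    c :+ (a :+ t) :* (ρ :+ t :* E) := (c :+ a :* ρ) :+ t :* (ρ :+ (a :+ t) :* E)) refl

  ⟦⟧-divide : ∀ {n} a (w : Poly (suc n)) x →
              ⟦ w ⟧ x ≡ proj₂ (divide a w) + (x - a) · ⟦ proj₁ (divide a w) ⟧ x
  ⟦⟧-divide a (c ∷ [])         x = cong (c +_) (trans (zeroʳ x) (sym (zeroʳ (x - a))))
  ⟦⟧-divide a (c ∷ cs@(_ ∷ _)) x with divide a cs | ⟦⟧-divide a cs x
  ... | Q , ρ | ⟦cs⟧ = begin
    c + x · ⟦ cs ⟧ x                           ≡⟨ cong (λ v → c + x · v) ⟦cs⟧ ⟩
    c + x · (ρ + (x - a) · ⟦ Q ⟧ x)            ≡⟨ subst step (a+[x-a]≡x a x) (horner-step c a (x - a) ρ (⟦ Q ⟧ x)) ⟩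
    (c + a · ρ) + (x - a) · (ρ + x · ⟦ Q ⟧ x)  ∎
    where
    open ≡-Reasoning
    step : Fin r → Set
    step y = c + y · (ρ + (x - a) · ⟦ Q ⟧ x) ≡ (c + a · ρ) + (x - a) · (ρ + y · ⟦ Q ⟧ x)

  divide-injective : ∀ {n} a {u v : Poly (suc n)} → divide a u ≡ divide a v → u ≡ v
  divide-injective a {c ∷ []}         {d ∷ []}         e = cong (_∷ []) (cong proj₂ e)
  divide-injective a {c ∷ u@(_ ∷ _)} {d ∷ v@(_ ∷ _)} e
    with divide a u in ≡divide-u | divide a v in ≡divide-v
  ... | Q , ρ | Q′ , ρ′ with ∷-injective (cong proj₁ e)
  ... | refl , refl =
    cong₂ _∷_ (+-cancelʳ (a · ρ) c d (cong proj₂ e)) (divide-injective a (trans ≡divide-u (sym ≡divide-v)))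

  ⟦⟧-divide-at : ∀ {n} a (w : Poly (suc n)) → ⟦ w ⟧ a ≡ proj₂ (divide a w)
  ⟦⟧-divide-at a w = begin
    ⟦ w ⟧ a                        ≡⟨ ⟦⟧-divide a w a ⟩
    ρ + (a - a) · ⟦ Q ⟧ a          ≡⟨ cong (λ t → ρ + t · ⟦ Q ⟧ a) (-‿inverseʳ a) ⟩
    ρ + 0# · ⟦ Q ⟧ a               ≡⟨ cong (ρ +_) (zeroˡ (⟦ Q ⟧ a)) ⟩
    ρ + 0#                         ≡⟨ +-identityʳ ρ ⟩
    ρ                              ∎
    where
    open ≡-Reasoning
    Q = proj₁ (divide a w)
    ρ = proj₂ (divide a w)

  agree⇒≡ : ∀ {n} (u v : Poly n) (xs : List (Fin r)) → Unique xs → n ≤ length xs →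
            All (λ x → ⟦ u ⟧ x ≡ ⟦ v ⟧ x) xs → u ≡ v
  agree⇒≡ []  [] _ _ _ _ = refl
  agree⇒≡ u@(_ ∷ _) v (a ∷ xs) (a∉xs ∷ xs-unique) (s≤s n≤|xs|) (uv-agree-a ∷ uv-agree) =
    divide-injective a (cong₂ _,_ quotients-equal remainders-equal)
    where
    remainders-equal : proj₂ (divide a u) ≡ proj₂ (divide a v)
    remainders-equal = trans (sym (⟦⟧-divide-at a u)) (trans uv-agree-a (⟦⟧-divide-at a v))
    quotients-agree : ∀ {x} → a ≢ x → ⟦ u ⟧ x ≡ ⟦ v ⟧ x →
                      ⟦ proj₁ (divide a u) ⟧ x ≡ ⟦ proj₁ (divide a v) ⟧ x
    quotients-agree {x} a≢x ux≡vx = *-cancelˡ-nonZero (x - a) (a≢x ∘ sym ∘ x∙y⁻¹≈ε⇒x≈y x a)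
      (+-cancelˡ (proj₂ (divide a u)) _ _ (begin
        proj₂ (divide a u) + (x - a) · ⟦ proj₁ (divide a u) ⟧ x   ≡⟨ ⟦⟧-divide a u x ⟨
        ⟦ u ⟧ x                                                  ≡⟨ ux≡vx ⟩
        ⟦ v ⟧ x                                                  ≡⟨ ⟦⟧-divide a v x ⟩
        proj₂ (divide a v) + (x - a) · ⟦ proj₁ (divide a v) ⟧ x   ≡⟨ cong (_+ _) remainders-equal ⟨
        proj₂ (divide a u) + (x - a) · ⟦ proj₁ (divide a v) ⟧ x   ∎))
      where open ≡-Reasoning
    quotients-equal : proj₁ (divide a u) ≡ proj₁ (divide a v)
    quotients-equal = agree⇒≡ _ _ xs xs-unique n≤|xs|
      (All.zipWith (λ (a≢x , agree) → quotients-agree a≢x agree) (a∉xs , uv-agree))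

  ≢⇒agree-≤ : ∀ {k} {u v : Poly (suc k)} → u ≢ v → (xs : List (Fin r)) → Unique xs →
              All (λ x → ⟦ u ⟧ x ≡ ⟦ v ⟧ x) xs → length xs ≤ k
  ≢⇒agree-≤ {k} {u} {v} u≢v xs xs-unique uv-agree with suc k ℕ.≤? length xs
  ... | yes k<|xs| = contradiction (agree⇒≡ u v xs xs-unique k<|xs| uv-agree) u≢v
  ... | no  k≮|xs| = ℕ.≤-pred (ℕ.≰⇒> k≮|xs|)

  separating-point : ∀ {k d} (f : Poly (suc k)) (gs : Fin d → Poly (suc k)) → (∀ a → gs a ≢ f) →
                     (xs : List (Fin r)) → Unique xs → suc (d ℕ.* k) ≤ length xs →
                     ∃ λ x → x ∈ xs × ∀ a → ⟦ gs a ⟧ x ≢ ⟦ f ⟧ x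
  separating-point {d = d} f gs gs≢f =
    avoid-sparse d (λ a x → ⟦ gs a ⟧ x ≡ ⟦ f ⟧ x) (λ a x → ⟦ gs a ⟧ x Fin.≟ ⟦ f ⟧ x)
                 (λ a → ≢⇒agree-≤ (gs≢f a))

  ⟦replicate-0#⟧ : ∀ n x → ⟦ replicate n 0# ⟧ x ≡ 0#
  ⟦replicate-0#⟧ zero    x = refl
  ⟦replicate-0#⟧ (suc n) x = begin
    0# + x · ⟦ replicate n 0# ⟧ x   ≡⟨ cong (λ v → 0# + x · v) (⟦replicate-0#⟧ n x) ⟩
    0# + x · 0#                     ≡⟨ cong (0# +_) (zeroʳ x) ⟩
    0# + 0#                         ≡⟨ +-identityʳ 0# ⟩
    0#                              ∎
    where open ≡-Reasoning

  ⟦⟧-padRight : ∀ {m n} (m≤n : m ≤ n) (v : Poly m) x → ⟦ padRight m≤n 0# v ⟧ x ≡ ⟦ v ⟧ x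
  ⟦⟧-padRight {n = n} z≤n [] x = ⟦replicate-0#⟧ n x
  ⟦⟧-padRight (s≤s m≤n) (c ∷ cs) x = cong (λ v → c + x · v) (⟦⟧-padRight m≤n cs x)

encodePoly : ∀ {r} n → Vec (Fin r) n → Fin (r ^ n)
encodePoly zero    []       = Fin.zero
encodePoly (suc n) (c ∷ cs) = combine c (encodePoly n cs)

decodePoly-combine : ∀ {r} n (c : Fin r) (i : Fin (r ^ n)) →
                     decodePoly {r} (suc n) (combine c i) ≡ c ∷ decodePoly n i
decodePoly-combine {r} n c i rewrite quotRem-combine (r ^ n) c i = refl

decodePoly-suc : ∀ {r} n (i : Fin (r ^ suc n)) →
                 decodePoly (suc n) i ≡ quotient {r} (r ^ n) i ∷ decodePoly n (remainder {r} (r ^ n) i)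
decodePoly-suc {r} n i with quotRem {r} (r ^ n) i
... | _ = refl

decodePoly-encodePoly : ∀ {r} n (v : Vec (Fin r) n) → decodePoly n (encodePoly n v) ≡ v
decodePoly-encodePoly zero    []       = refl
decodePoly-encodePoly (suc n) (c ∷ cs) =
  trans (decodePoly-combine n c (encodePoly n cs)) (cong (c ∷_) (decodePoly-encodePoly n cs))

encodePoly-decodePoly : ∀ {r} n (i : Fin (r ^ n)) → encodePoly n (decodePoly n i) ≡ i
encodePoly-decodePoly zero    Fin.zero = refl
encodePoly-decodePoly {r} (suc n) i rewrite decodePoly-suc {r} n i =
  trans (cong (combine (quotient {r} (r ^ n) i)) (encodePoly-decodePoly {r} n _))
        (combine-remQuot {r} (r ^ n) i)

decodePoly-injective : ∀ {r} n {i j : Fin (r ^ n)} → decodePoly n i ≡ decodePoly n j → i ≡ j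
decodePoly-injective n {i} {j} e =
  trans (sym (encodePoly-decodePoly n i)) (trans (cong (encodePoly n) e) (encodePoly-decodePoly n j))

encodePoly-injective : ∀ {r} n → Injective _≡_ _≡_ (encodePoly {r} n)
encodePoly-injective n {u} {v} e =
  trans (sym (decodePoly-encodePoly n u)) (trans (cong (decodePoly n) e) (decodePoly-encodePoly n v))

module _ {r} (F : FiniteField r) (κ δ : ℕ) (h : suc (δ * κ) ≤ r) where

  polyOf : Fin (r ^ suc κ) → Vec (Fin r) (suc κ)
  polyOf = decodePoly (suc κ)

  C-combine : ∀ i y col →
              C F κ δ h (combine i y) col ≡ isYes (eval F (polyOf col) (inject≤ i h) Fin.≟ y)
  C-combine i y col rewrite quotRem-combine r i y = refl

  C-isCFF : IsCFF δ (C F κ δ h)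
  C-isCFF j₀ S _ S≢j₀ with separating-point (polyOf j₀) (polyOf ∘ S)
                                             (λ a → S≢j₀ a ∘ decodePoly-injective (suc κ))
                                             points points-unique |points|
    where
    open FieldPolynomials F using (separating-point)
    points = List.map (λ i → inject≤ i h) (allFin (suc (δ * κ)))
    points-unique : Unique points
    points-unique = Unique.map⁺ (Fin.inject≤-injective h h _ _) (Unique.allFin⁺ _)
    |points| : suc (δ * κ) ≤ length points
    |points| = ℕ.≤-reflexive (sym (trans (length-map (λ i → inject≤ i h) (allFin _))
                                         (length-tabulate (λ i → i))))
  ... | x , x∈points , separated with ∈-map⁻ (λ i → inject≤ i h) x∈points
  ... | i , _ , refl = combine i y , on-j₀ , off-S
    where
    y = eval F (polyOf j₀) (inject≤ i h)
    on-j₀ : C F κ δ h (combine i y) j₀ ≡ true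
    on-j₀ = trans (C-combine i y j₀) (trans (isYes≗does (y Fin.≟ y)) (dec-true (y Fin.≟ y) refl))
    off-S : ∀ a → C F κ δ h (combine i y) (S a) ≡ false
    off-S a = trans (C-combine i y (S a))
                    (trans (isYes≗does (_ Fin.≟ y)) (dec-false (_ Fin.≟ y) (separated a)))

permute-isCFF : ∀ {t n d} {M : Fin t → Fin n → Bool} (σ : Permutation′ t) (τ : Permutation′ n) →
                IsCFF d M → IsCFF d (permute M σ τ)
permute-isCFF {M = M} σ τ M-isCFF j₀ S S-injective S≢j₀
  with M-isCFF (τ ⟨$⟩ʳ j₀) ((τ ⟨$⟩ʳ_) ∘ S) (S-injective ∘ τʳ-injective) (λ a → S≢j₀ a ∘ τʳ-injective)
  where
  τʳ-injective : ∀ {i j} → τ ⟨$⟩ʳ i ≡ τ ⟨$⟩ʳ j → i ≡ j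
  τʳ-injective {i} {j} e = trans (sym (inverseˡ τ)) (trans (cong (τ ⟨$⟩ˡ_) e) (inverseˡ τ))
... | x , on-j₀ , off-S =
  σ ⟨$⟩ˡ x , subst (λ z → M z _ ≡ true) (sym (inverseʳ σ)) on-j₀ ,
             λ a → subst (λ z → M z _ ≡ false) (sym (inverseʳ σ)) (off-S a)

transpose-matchˡ : ∀ {n} (i j : Fin n) → PC.transpose i j i ≡ j
transpose-matchˡ i j rewrite dec-true (i Fin.≟ i) refl = refl

transpose-fixes : ∀ {n} {i j k : Fin n} → k ≢ i → k ≢ j → PC.transpose i j k ≡ k
transpose-fixes {i = i} {j} {k} k≢i k≢j rewrite dec-false (k Fin.≟ i) k≢i | dec-false (k Fin.≟ j) k≢j = refl

-- Extend f ∘ inject₁ to π; a transposition in front of π then routes the last point to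
-- the preimage of its image.
extend-injection : ∀ {a b} {f : Fin a → Fin b} (f-injective : Injective _≡_ _≡_ f) →
                   Σ (Permutation′ b) λ π → ∀ i → π ⟨$⟩ʳ inject≤ i (injective⇒≤ f-injective) ≡ f i
extend-injection {zero}          _           = id , λ ()
extend-injection {suc a} {f = f} f-injective
  with extend-injection {f = f ∘ inject₁} (Fin.inject₁-injective ∘ f-injective)
... | π , π-extends = transpose last u ∘ₚ π , extends
  where
  last = inject≤ (fromℕ a) (injective⇒≤ f-injective)
  u    = π ⟨$⟩ˡ f (fromℕ a)
  extends : ∀ i → π ⟨$⟩ʳ PC.transpose last u (inject≤ i (injective⇒≤ f-injective)) ≡ f i
  extends i with view i
  ... | ‵fromℕ     = trans (cong (π ⟨$⟩ʳ_) (transpose-matchˡ last u)) (inverseʳ π)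
  ... | ‵inject₁ j = begin
    π ⟨$⟩ʳ PC.transpose last u j′  ≡⟨ cong (π ⟨$⟩ʳ_) (transpose-fixes j′≢last j′≢u) ⟩
    π ⟨$⟩ʳ j′                      ≡⟨ cong (π ⟨$⟩ʳ_) j′≡ ⟩
    π ⟨$⟩ʳ inject≤ j _             ≡⟨ π-extends j ⟩
    f (inject₁ j)                  ∎
    where
    open ≡-Reasoning
    j′ = inject≤ (inject₁ j) (injective⇒≤ f-injective)
    j′≡ : j′ ≡ inject≤ j (injective⇒≤ (Fin.inject₁-injective ∘ f-injective))
    j′≡ = toℕ-injective (trans (toℕ-inject≤ _ _) (trans (Fin.toℕ-inject₁ j) (sym (toℕ-inject≤ j _))))
    j′≢last : j′ ≢ last
    j′≢last = Fin.fromℕ≢inject₁ ∘ sym ∘ Fin.inject≤-injective _ _ _ _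
    j′≢u : j′ ≢ u
    j′≢u j′≡u = Fin.fromℕ≢inject₁ (sym (f-injective (begin
      f (inject₁ j)          ≡⟨ π-extends j ⟨
      π ⟨$⟩ʳ inject≤ j _     ≡⟨ cong (π ⟨$⟩ʳ_) (trans (sym j′≡) j′≡u) ⟩
      π ⟨$⟩ʳ u               ≡⟨ inverseʳ π ⟩
      f (fromℕ a)            ∎)))

submatrix⇒topLeftBlock : ∀ {t n t′ n′} (M : Fin t → Fin n → Bool) (A : Fin t′ → Fin n′ → Bool)
                         {ρ : Fin t′ → Fin t} {θ : Fin n′ → Fin n} →
                         Injective _≡_ _≡_ ρ → Injective _≡_ _≡_ θ → (∀ i j → M (ρ i) (θ j) ≡ A i j) →
                         Σ (Permutation′ t) λ σ → Σ (Permutation′ n) λ τ → TopLeftBlock (permute M σ τ) A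
submatrix⇒topLeftBlock M A {ρ} {θ} ρ-injective θ-injective M[ρ,θ]≡A
  with extend-injection ρ-injective | extend-injection θ-injective
... | σ , σ-extends | τ , τ-extends = σ , τ , injective⇒≤ ρ-injective , injective⇒≤ θ-injective , block
  where
  block : ∀ i j i′ j′ → toℕ i ≡ toℕ i′ → toℕ j ≡ toℕ j′ → permute M σ τ i′ j′ ≡ A i j
  block i j i′ j′ i≡i′ j≡j′ = begin
    M (σ ⟨$⟩ʳ i′) (τ ⟨$⟩ʳ j′)                    ≡⟨ cong₂ (λ i″ j″ → M (σ ⟨$⟩ʳ i″) (τ ⟨$⟩ʳ j″))
                                                        (inject≤-≡ i i′ i≡i′) (inject≤-≡ j j′ j≡j′) ⟨
    M (σ ⟨$⟩ʳ inject≤ i _) (τ ⟨$⟩ʳ inject≤ j _)  ≡⟨ cong₂ M (σ-extends i) (τ-extends j) ⟩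
    M (ρ i) (θ j)                                ≡⟨ M[ρ,θ]≡A i j ⟩
    A i j                                        ∎
    where
    open ≡-Reasoning
    inject≤-≡ : ∀ {m m′} .{m≤m′ : m ≤ m′} (i : Fin m) (i′ : Fin m′) → toℕ i ≡ toℕ i′ → inject≤ i m≤m′ ≡ i′
    inject≤-≡ i i′ i≡i′ = toℕ-injective (trans (toℕ-inject≤ i _) i≡i′)

module Subfield {q Q} {F : FiniteField q} {K : FiniteField Q} {ι : Fin q → Fin Q}
                (ι-compatible : CompatibleSubfield F K ι) where

  open CompatibleSubfield ι-compatible
  private
    module F = FiniteField F
    module K = FiniteField K

  ι-injective : Injective _≡_ _≡_ ι
  ι-injective {a} {b} ιa≡ιb = toℕ-injective (trans (sym (ordered a)) (trans (cong toℕ ιa≡ιb) (ordered b)))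

  eval-map-ι : ∀ {n} (v : Vec (Fin q) n) x → eval K (map ι v) (ι x) ≡ ι (eval F v x)
  eval-map-ι []       x = sym pres-0
  eval-map-ι (c ∷ cs) x = begin
    ι c K.+ (ι x K.* eval K (map ι cs) (ι x))   ≡⟨ cong (λ v → ι c K.+ (ι x K.* v)) (eval-map-ι cs x) ⟩
    ι c K.+ (ι x K.* ι (eval F cs x))           ≡⟨ cong (ι c K.+_) (pres-* x _) ⟨
    ι c K.+ ι (x F.* eval F cs x)               ≡⟨ pres-+ c _ ⟨
    ι (c F.+ (x F.* eval F cs x))               ∎
    where open ≡-Reasoning

  module Embedding {k k′ d d′} (hq : suc (d * k) ≤ q) (hQ : suc (d′ * k′) ≤ Q)
                   (k≤k′ : k ≤ k′) (d≤d′ : d ≤ d′) where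

    Cᶠ : Fin (suc (d * k) * q) → Fin (q ^ suc k) → Bool
    Cᶠ = C F k d hq

    Cᴷ : Fin (suc (d′ * k′) * Q) → Fin (Q ^ suc k′) → Bool
    Cᴷ = C K k′ d′ hQ

    points≤ : suc (d * k) ≤ suc (d′ * k′)
    points≤ = s≤s (ℕ.*-mono-≤ d≤d′ k≤k′)

    pointEmbedding : Fin (suc (d * k)) → Fin (suc (d′ * k′))
    pointEmbedding i = inject≤ i points≤

    rowEmbedding : Fin (suc (d * k) * q) → Fin (suc (d′ * k′) * Q)
    rowEmbedding = combine-map pointEmbedding ι

    columnEmbedding : Fin (q ^ suc k) → Fin (Q ^ suc k′)
    columnEmbedding = encodePoly (suc k′) ∘ padRight (s≤s k≤k′) K.0# ∘ map ι ∘ decodePoly (suc k)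

    rowEmbedding-injective : Injective _≡_ _≡_ rowEmbedding
    rowEmbedding-injective =
      combine-map-injective pointEmbedding ι (Fin.inject≤-injective _ _ _ _) ι-injective

    columnEmbedding-injective : Injective _≡_ _≡_ columnEmbedding
    columnEmbedding-injective = decodePoly-injective (suc k) ∘ map-injective ι-injective
                              ∘ padRight-injective (s≤s k≤k′) K.0# ∘ encodePoly-injective (suc k′)

    C-restricts-combine : ∀ i y col →
                          Cᴷ (rowEmbedding (combine i y)) (columnEmbedding col) ≡ Cᶠ (combine i y) col
    C-restricts-combine i y col = begin
      Cᴷ (rowEmbedding (combine i y)) (columnEmbedding col)
        ≡⟨ cong (λ row → Cᴷ row (columnEmbedding col)) (combine-map-combine pointEmbedding ι i y) ⟩
      Cᴷ (combine (inject≤ i points≤) (ι y)) (columnEmbedding col)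
        ≡⟨ C-combine K k′ d′ hQ _ (ι y) (columnEmbedding col) ⟩
      isYes (eval K (decodePoly (suc k′) (columnEmbedding col)) (inject≤ (inject≤ i points≤) hQ) Fin.≟ ι y)
        ≡⟨ cong₂ (λ w z → isYes (eval K w z Fin.≟ ι y)) (decodePoly-encodePoly (suc k′) _) point≡ ⟩
      isYes (eval K (padRight (s≤s k≤k′) K.0# (map ι v)) (ι x) Fin.≟ ι y)
        ≡⟨ cong (λ z → isYes (z Fin.≟ ι y))
                (trans (⟦⟧-padRight (s≤s k≤k′) (map ι v) (ι x)) (eval-map-ι v x)) ⟩
      isYes (ι (eval F v x) Fin.≟ ι y)
        ≡⟨ isYes-≟-injective ι-injective _ y ⟩
      isYes (eval F v x Fin.≟ y)
        ≡⟨ C-combine F k d hq i y col ⟨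
      Cᶠ (combine i y) col
        ∎
      where
      open ≡-Reasoning
      open FieldPolynomials K using (⟦⟧-padRight)
      v = decodePoly (suc k) col
      x = inject≤ i hq
      point≡ : inject≤ (inject≤ i points≤) hQ ≡ ι x
      point≡ = toℕ-injective (trans (toℕ-inject≤ _ hQ)
                             (trans (toℕ-inject≤ i points≤) (sym (trans (ordered x) (toℕ-inject≤ i hq)))))

    C-restricts : ∀ row col → Cᴷ (rowEmbedding row) (columnEmbedding col) ≡ Cᶠ row col
    C-restricts row col = subst (λ row → Cᴷ (rowEmbedding row) (columnEmbedding col) ≡ Cᶠ row col)
                                (combine-remQuot {suc (d * k)} q row)
                                (C-restricts-combine (quotient q row) (remainder {suc (d * k)} q row) col)

theorem3 : (q k k′ d d′ : ℕ) → IsPrimePower q →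
  (F : FiniteField q) (K : FiniteField (q ^ 2)) (ι : Fin q → Fin (q ^ 2)) →
  CompatibleSubfield F K ι →
  1 ≤ k → 1 ≤ k′ → 1 ≤ d → 1 ≤ d′ →
  (hq : suc (d * k) ≤ q) → k ≤ k′ → d ≤ d′ → (hQ : suc (d′ * k′) ≤ q ^ 2) →
  Σ (Permutation′ (suc (d′ * k′) * q ^ 2)) λ σ →
  Σ (Permutation′ ((q ^ 2) ^ suc k′)) λ τ →
    TopLeftBlock (permute (C K k′ d′ hQ) σ τ) (C F k d hq)
    × IsCFF d′ (permute (C K k′ d′ hQ) σ τ)
    × IsCFF d (C F k d hq)
theorem3 q k k′ d d′ _ F K ι ι-compatible _ _ _ _ hq k≤k′ d≤d′ hQ
  with submatrix⇒topLeftBlock (C K k′ d′ hQ) (C F k d hq)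
                              rowEmbedding-injective columnEmbedding-injective C-restricts
  where open Subfield.Embedding ι-compatible hq hQ k≤k′ d≤d′
... | σ , τ , topLeft = σ , τ , topLeft , permute-isCFF σ τ (C-isCFF K k′ d′ hQ) , C-isCFF F k d hq
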